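{- Let $G$ be a singular bipartite graph with $\eta(G)=1$. Then the set $CV$ of core vertices of $G$ is an independent set (so $G$ admits a core-labelling).
   Context: $\eta(G)=\dim\ker\mathbf{A}$ for the $\{0,1\}$-adjacency matrix $\mathbf{A}$ of $G$. A vertex $v$ is a core vertex if some $\mathbf{x}\in\ker\mathbf{A}$ has $x_v\neq0$. A core-labelling of a singular graph with independent $CV$ lists first the vertices of $CV$, then their neighbours, then the remaining vertices.
   Formalization: The kernel of $\mathbf{A}$, which defines $\eta(G)$ and the core vertices, is taken over ℚ. -}

module Defs where

open import Data.Nat using (ℕ; zero; suc)
open import Data.Fin using (Fin; zero; suc)
open import Data.Bool using (Bool; true; false)
open import Data.Rational using (ℚ; 0ℚ; 1ℚ; _+_; _*_)
open import Data.Product using (Σ; ∃; _×_; _,_)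
open import Relation.Binary.PropositionalEquality using (_≡_; _≢_)
open import Relation.Nullary using (¬_)

record Graph (n : ℕ) : Set where
  field
    adj   : Fin n → Fin n → Bool
    sym   : ∀ i j → adj i j ≡ adj j i
    irrefl : ∀ i → adj i i ≡ false
open Graph public

Σ[_] : ∀ {n} → (Fin n → ℚ) → ℚ
Σ[_] {zero}  f = 0ℚ
Σ[_] {suc n} f = f zero + Σ[_] (λ i → f (suc i))

A : ∀ {n} → Graph n → Fin n → Fin n → ℚ
A G i j with adj G i j
... | true  = 1ℚ
... | false = 0ℚ

InKer : ∀ {n} → Graph n → (Fin n → ℚ) → Set
InKer G x = ∀ i → Σ[ (λ j → A G i j * x j) ] ≡ 0ℚ

Nonzero : ∀ {n} → (Fin n → ℚ) → Set
Nonzero x = ∃ λ i → x i ≢ 0ℚ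

-- η(G) = dim ker A = 1 : the kernel is spanned by a single nonzero vector
NullityOne : ∀ {n} → Graph n → Set
NullityOne {n} G =
  Σ (Fin n → ℚ) λ x → InKer G x × Nonzero x ×
    (∀ y → InKer G y → ∃ λ c → ∀ i → y i ≡ c * x i)

Bipartite : ∀ {n} → Graph n → Set
Bipartite {n} G = Σ (Fin n → Bool) λ c → ∀ i j → adj G i j ≡ true → ¬ (c i ≡ c j)

CoreVertex : ∀ {n} → Graph n → Fin n → Set
CoreVertex {n} G v = Σ (Fin n → ℚ) λ x → InKer G x × x v ≢ 0ℚ

CoreIndependent : ∀ {n} → Graph n → Set
CoreIndependent G = ∀ u v → CoreVertex G u → CoreVertex G v → adj G u v ≡ false

-- In a bipartite graph, keeping the entries of a kernel vector on one colour
-- class and zeroing the rest gives again a kernel vector, since A maps each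
-- class into the other.  When η(G) = 1 with generator x, every core vertex has
-- x ≠ 0 there, and the restriction of x to the class of u is a multiple a·x.
-- If u ~ v were adjacent core vertices, v lies in the other class, so
-- a·x v = 0 forces a = 0, and then x u = a·x u = 0: a contradiction.
module Submission where

open import Defs hiding (sym)
open import Data.Nat using (ℕ; zero; suc)
open import Data.Fin using (Fin; zero; suc)
open import Data.Bool using (Bool; true; false; if_then_else_)
open import Data.Bool.Properties using (_≟_; ¬-not)
open import Data.Rational using (ℚ; 0ℚ; 1ℚ; _+_; _*_; 1/_; ≢-nonZero)
open import Data.Rational.Properties using (*-zeroˡ; *-zeroʳ; *-identityʳ; *-assoc; *-inverseʳ)
open import Data.Product using (∃; _,_)
open import Function using (_∘_)
open import Relation.Binary.PropositionalEquality
open import Relation.Nullary using (yes; no; does; contradiction)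

Σ-cong : ∀ {n} {f g : Fin n → ℚ} → (∀ j → f j ≡ g j) → Σ[ f ] ≡ Σ[ g ]
Σ-cong {zero}  e = refl
Σ-cong {suc n} e = cong₂ _+_ (e zero) (Σ-cong (e ∘ suc))

Σ-zero : ∀ {n} {f : Fin n → ℚ} → (∀ j → f j ≡ 0ℚ) → Σ[ f ] ≡ 0ℚ
Σ-zero {zero}  e = refl
Σ-zero {suc n} e = cong₂ _+_ (e zero) (Σ-zero (e ∘ suc))

p*q≡0⇒p≡0 : ∀ p q → p * q ≡ 0ℚ → q ≢ 0ℚ → p ≡ 0ℚ
p*q≡0⇒p≡0 p q pq≡0 q≢0 = begin
  p                ≡⟨ sym (*-identityʳ p) ⟩
  p * 1ℚ           ≡⟨ cong (p *_) (sym (*-inverseʳ q)) ⟩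
  p * (q * 1/ q)   ≡⟨ sym (*-assoc p q (1/ q)) ⟩
  (p * q) * 1/ q   ≡⟨ cong (_* 1/ q) pq≡0 ⟩
  0ℚ * 1/ q        ≡⟨ *-zeroˡ (1/ q) ⟩
  0ℚ               ∎
  where
  open ≡-Reasoning
  instance _ = ≢-nonZero q≢0

≢-≢⇒≡ : ∀ {x y z : Bool} → x ≢ y → y ≢ z → x ≡ z
≢-≢⇒≡ x≢y y≢z = trans (¬-not x≢y) (sym (¬-not (y≢z ∘ sym)))

A-cong : ∀ {n} (G : Graph n) i j {p q : ℚ} →
         (adj G i j ≡ true → p ≡ q) → A G i j * p ≡ A G i j * q
A-cong G i j {p} {q} h with adj G i j
... | true  = cong (1ℚ *_) (h refl)
... | false = trans (*-zeroˡ p) (sym (*-zeroˡ q))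

ProperColouring : ∀ {n} → Graph n → (Fin n → Bool) → Set
ProperColouring G c = ∀ i j → adj G i j ≡ true → c i ≢ c j

restrict : ∀ {n} → (Fin n → Bool) → Bool → (Fin n → ℚ) → Fin n → ℚ
restrict c b x i = if does (c i ≟ b) then x i else 0ℚ

module _ {n} (c : Fin n → Bool) (b : Bool) (x : Fin n → ℚ) {i : Fin n} where

  restrict-in : c i ≡ b → restrict c b x i ≡ x i
  restrict-in cᵢ≡b with c i ≟ b
  ... | yes _    = refl
  ... | no cᵢ≢b = contradiction cᵢ≡b cᵢ≢b

  restrict-out : c i ≢ b → restrict c b x i ≡ 0ℚ
  restrict-out cᵢ≢b with c i ≟ b
  ... | yes cᵢ≡b = contradiction cᵢ≡b cᵢ≢b
  ... | no _     = refl

restrict-InKer : ∀ {n} (G : Graph n) {c} → ProperColouring G c →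
                 ∀ b {x} → InKer G x → InKer G (restrict c b x)
restrict-InKer G {c} proper b {x} kx i with c i ≟ b
... | yes cᵢ≡b = Σ-zero λ j →
  trans (A-cong G i j λ aᵢⱼ → restrict-out c b x λ cⱼ≡b →
           proper i j aᵢⱼ (trans cᵢ≡b (sym cⱼ≡b)))
        (*-zeroʳ (A G i j))
... | no cᵢ≢b = trans
  (Σ-cong λ j → A-cong G i j λ aᵢⱼ → restrict-in c b x (≢-≢⇒≡ (proper i j aᵢⱼ ∘ sym) cᵢ≢b))
  (kx i)

Spans : ∀ {n} → Graph n → (Fin n → ℚ) → Set
Spans G x = ∀ y → InKer G y → ∃ λ a → ∀ i → y i ≡ a * x i

module _ {n} (G : Graph n) {x : Fin n → ℚ} (spans : Spans G x) where

  core⇒generator≢0 : ∀ {v} → CoreVertex G v → x v ≢ 0ℚ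
  core⇒generator≢0 {v} (y , ky , yᵥ≢0) xᵥ≡0 with spans y ky
  ... | a , y≡ax = yᵥ≢0 (trans (y≡ax v) (trans (cong (a *_) xᵥ≡0) (*-zeroʳ a)))

  kernel-≡0-on-support⇒≡0 : ∀ {z v} → InKer G z → x v ≢ 0ℚ → z v ≡ 0ℚ → ∀ i → z i ≡ 0ℚ
  kernel-≡0-on-support⇒≡0 {z} {v} kz xᵥ≢0 zᵥ≡0 i with spans z kz
  ... | a , z≡ax = trans (z≡ax i) (trans (cong (_* x i) a≡0) (*-zeroˡ (x i)))
    where
    a≡0 : a ≡ 0ℚ
    a≡0 = p*q≡0⇒p≡0 a (x v) (trans (sym (z≡ax v)) zᵥ≡0) xᵥ≢0

mainTheorem8 : ∀ {n : ℕ} (G : Graph n) → Bipartite G → NullityOne G → CoreIndependent G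
mainTheorem8 G (c , proper) (x , kx , _ , spans) u v core-u core-v with adj G u v in aᵤᵥ
... | false = refl
... | true  = contradiction xᵤ≡0 (core⇒generator≢0 G spans core-u)
  where
  zᵥ≡0 : restrict c (c u) x v ≡ 0ℚ
  zᵥ≡0 = restrict-out c (c u) x λ cᵥ≡cᵤ → proper u v aᵤᵥ (sym cᵥ≡cᵤ)

  xᵤ≡0 : x u ≡ 0ℚ
  xᵤ≡0 = trans (sym (restrict-in c (c u) x refl))
    (kernel-≡0-on-support⇒≡0 G spans (restrict-InKer G proper (c u) kx)
      (core⇒generator≢0 G spans core-v) zᵥ≡0 u)
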